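{- There are models of the theory $\mathsf{ID}$ in which, for every nonempty binary string $\alpha$, there exist infinitely many pairs $x, y$ with $x y = \overline{\alpha}$. For example, take as universe the Cartesian product $\prod_{i<\omega}\{\boldsymbol{0},\boldsymbol{1}\}^*$, interpret concatenation componentwise, and map each binary string $\beta$ to the constant sequence $(\beta)_{i<\omega}$.
   Context: $\mathsf{ID}$ is the theory in the language $\{0,1,\circ,\preceq\}$ with axioms: $\mathsf{ID}_1$: $\forall x y z\,[(xy)z = x(yz)]$; $\mathsf{ID}_2$: $\forall x y\,[x\neq y \to (x0\neq y0 \wedge x1\neq y1)]$; $\mathsf{ID}_3$: $\forall x y\,[x0\neq y1]$; and the schema $\mathsf{ID}_4$: $\forall x\,[x\preceq\overline{\alpha}\leftrightarrow\bigvee_{\gamma\in\mathsf{Pref}(\alpha)} x=\overline{\gamma}]$ for each nonempty binary string $\alpha$, where $\mathsf{Pref}(\alpha)$ is the set of nonempty prefixes of $\alpha$ and $\overline{\alpha}$ is the canonical variable-free term (biteral) denoting $\alpha$. Juxtaposition denotes $\circ$. $\{\boldsymbol{0},\boldsymbol{1}\}^*$ is the set of all finite binary strings (including the empty one). -}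

module Defs where

open import Data.Bool using (Bool; true; false)
open import Data.List using (List; []; _∷_; foldl; map)
open import Data.List.NonEmpty using (List⁺; _∷_)
open import Data.List.Relation.Unary.Any using (Any)
open import Data.Product using (_×_)
open import Relation.Binary.PropositionalEquality using (_≡_; _≢_)
open import Function.Bundles using (_⇔_)

-- Binary strings: lists of bits, false = 𝟎, true = 𝟏.
-- Nonempty binary strings: List⁺ Bool.

prefixes : List⁺ Bool → List (List⁺ Bool)
prefixes (b ∷ bs) = (b ∷ []) ∷ map (λ γ → extend b γ) (prefixes' bs)
  where
  prefixes' : List Bool → List (List Bool)
  prefixes' [] = []
  prefixes' (c ∷ cs) = (c ∷ []) ∷ map (c ∷_) (prefixes' cs)
  extend : Bool → List Bool → List⁺ Bool
  extend b cs = b ∷ cs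

record IDStructure : Set₁ where
  infixl 7 _∘_
  infix 4 _≼_
  field
    Carrier : Set
    𝟘 𝟙     : Carrier
    _∘_     : Carrier → Carrier → Carrier
    _≼_     : Carrier → Carrier → Set

  bit : Bool → Carrier
  bit false = 𝟘
  bit true  = 𝟙

  biteral : List⁺ Bool → Carrier
  biteral (b ∷ bs) = foldl (λ t c → t ∘ bit c) (bit b) bs

-- The axioms of ID, with equality interpreted as true equality.
record IsID (M : IDStructure) : Set where
  open IDStructure M
  field
    ID₁ : ∀ x y z → (x ∘ y) ∘ z ≡ x ∘ (y ∘ z)
    ID₂ : ∀ x y → x ≢ y → (x ∘ 𝟘 ≢ y ∘ 𝟘) × (x ∘ 𝟙 ≢ y ∘ 𝟙)
    ID₃ : ∀ x y → x ∘ 𝟘 ≢ y ∘ 𝟙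
    ID₄ : ∀ (α : List⁺ Bool) x →
          (x ≼ biteral α) ⇔ Any (λ γ → x ≡ biteral γ) (prefixes α)

record IDModel : Set₁ where
  field
    structure : IDStructure
    isID      : IsID structure
  open IDStructure structure public

{-# OPTIONS --safe #-}
module Submission where

-- Take the direct product of the group ℤ with the free monoid {𝟎,𝟏}*. The free-monoid
-- factor alone makes ID₁–ID₃ hold (ℤ is cancellative, so it does no harm), and every
-- biteral has ℤ-component 0. Hence ᾱ = (n, ε)(−n, α) for every n ∈ ℕ. This replaces the
-- paper's power ∏_{i<ω} {𝟎,𝟏}*, whose equality would require function extensionality.

open import Defs
open import Data.Bool using (Bool; true; false)
open import Data.Empty using (⊥)
open import Data.Integer as ℤ using (ℤ; +_; -_; 0ℤ)
open import Data.Integer.Properties as ℤ using ()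
open import Data.List using (List; []; _∷_; _++_; _∷ʳ_; foldl)
open import Data.List.NonEmpty using (List⁺; _∷_; toList)
open import Data.List.Properties using (++-assoc; ++-identityʳ; ∷ʳ-injectiveˡ; ∷ʳ-injectiveʳ)
open import Data.List.Relation.Unary.Any as Any using (Any)
open import Data.Nat using (ℕ)
open import Data.Product using (Σ; _×_; _,_; proj₁; proj₂)
open import Function.Base using (_∘_)
open import Function.Bundles using (_⇔_; mk⇔)
open import Function.Definitions using (Injective)
open import Relation.Binary.PropositionalEquality

PrefixOf : {C : Set} → (List⁺ Bool → C) → C → C → Set
PrefixOf ⟦_⟧ x y = Σ (List⁺ Bool) λ α → y ≡ ⟦ α ⟧ × Any (λ γ → x ≡ ⟦ γ ⟧) (prefixes α)

prefixOf⇔ : {C : Set} {⟦_⟧ ⟪_⟫ : List⁺ Bool → C} →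
            Injective _≡_ _≡_ ⟦_⟧ → (∀ α → ⟪ α ⟫ ≡ ⟦ α ⟧) →
            ∀ α x → PrefixOf ⟦_⟧ x ⟪ α ⟫ ⇔ Any (λ γ → x ≡ ⟪ γ ⟫) (prefixes α)
prefixOf⇔ {⟦_⟧ = ⟦_⟧} {⟪_⟫} ⟦⟧-injective ⟪⟫≡⟦⟧ α x = mk⇔ to from
  where
  to : PrefixOf ⟦_⟧ x ⟪ α ⟫ → Any (λ γ → x ≡ ⟪ γ ⟫) (prefixes α)
  to (β , ⟪α⟫≡⟦β⟧ , x∈) with ⟦⟧-injective (trans (sym (⟪⟫≡⟦⟧ α)) ⟪α⟫≡⟦β⟧)
  ... | refl = Any.map (λ x≡⟦γ⟧ → trans x≡⟦γ⟧ (sym (⟪⟫≡⟦⟧ _))) x∈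

  from : Any (λ γ → x ≡ ⟪ γ ⟫) (prefixes α) → PrefixOf ⟦_⟧ x ⟪ α ⟫
  from x∈ = α , ⟪⟫≡⟦⟧ α , Any.map (λ x≡⟪γ⟫ → trans x≡⟪γ⟫ (⟪⟫≡⟦⟧ _)) x∈

Word : Set
Word = ℤ × List Bool

infixl 7 _·_
_·_ : Word → Word → Word
(m , s) · (n , t) = (m ℤ.+ n , s ++ t)

⟦_⟧ : List⁺ Bool → Word
⟦ α ⟧ = (0ℤ , toList α)

⟦⟧-injective : Injective _≡_ _≡_ ⟦_⟧
⟦⟧-injective {_ ∷ _} {_ ∷ _} refl = refl

structure : IDStructure
structure = record
  { Carrier = Word
  ; 𝟘 = ⟦ false ∷ [] ⟧
  ; 𝟙 = ⟦ true ∷ [] ⟧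
  ; _∘_ = _·_
  ; _≼_ = PrefixOf ⟦_⟧
  }

open IDStructure structure using (bit; biteral)

bit≡⟦⟧ : ∀ c → bit c ≡ ⟦ c ∷ [] ⟧
bit≡⟦⟧ false = refl
bit≡⟦⟧ true  = refl

foldl-bit : ∀ s bs → foldl (λ t c → t · bit c) (0ℤ , s) bs ≡ (0ℤ , s ++ bs)
foldl-bit s []       = cong (0ℤ ,_) (sym (++-identityʳ s))
foldl-bit s (c ∷ bs) rewrite bit≡⟦⟧ c = begin
  foldl _ (0ℤ , s ∷ʳ c) bs ≡⟨ foldl-bit (s ∷ʳ c) bs ⟩
  (0ℤ , (s ∷ʳ c) ++ bs)    ≡⟨ cong (0ℤ ,_) (++-assoc s (c ∷ []) bs) ⟩
  (0ℤ , s ++ c ∷ bs)       ∎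
  where open ≡-Reasoning

biteral≡⟦⟧ : ∀ α → biteral α ≡ ⟦ α ⟧
biteral≡⟦⟧ (b ∷ bs) rewrite bit≡⟦⟧ b = foldl-bit (b ∷ []) bs

+0-injective : ∀ m n → m ℤ.+ 0ℤ ≡ n ℤ.+ 0ℤ → m ≡ n
+0-injective m n eq = trans (sym (ℤ.+-identityʳ m)) (trans eq (ℤ.+-identityʳ n))

·-rightCancel : ∀ x y c → x · ⟦ c ∷ [] ⟧ ≡ y · ⟦ c ∷ [] ⟧ → x ≡ y
·-rightCancel (m , s) (n , t) c eq = cong₂ _,_
  (+0-injective m n (cong proj₁ eq)) (∷ʳ-injectiveˡ s t (cong proj₂ eq))

isID : IsID structure
isID = record
  { ID₁ = λ { (l , r) (m , s) (n , t) → cong₂ _,_ (ℤ.+-assoc l m n) (++-assoc r s t) }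
  ; ID₂ = λ x y x≢y → (λ eq → x≢y (·-rightCancel x y false eq))
                    , (λ eq → x≢y (·-rightCancel x y true eq))
  ; ID₃ = λ { (_ , s) (_ , t) eq → false≢true (∷ʳ-injectiveʳ s t (cong proj₂ eq)) }
  ; ID₄ = prefixOf⇔ ⟦⟧-injective biteral≡⟦⟧
  }
  where
  false≢true : false ≡ true → ⊥
  false≢true ()

model : IDModel
model = record { structure = structure ; isID = isID }

splitting : List⁺ Bool → ℕ → Word × Word
splitting α n = ((+ n , []) , (- (+ n) , toList α))

splitting-injective : ∀ α → Injective _≡_ _≡_ (splitting α)
splitting-injective α eq = ℤ.+-injective (cong (proj₁ ∘ proj₁) eq)

splitting-product : ∀ α n → proj₁ (splitting α n) · proj₂ (splitting α n) ≡ ⟦ α ⟧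
splitting-product α n = cong (_, toList α) (ℤ.+-inverseʳ (+ n))

mainTheorem5 : Σ IDModel λ M →
                 (α : List⁺ Bool) →
                   Σ (ℕ → IDModel.Carrier M × IDModel.Carrier M) λ f →
                     Injective _≡_ _≡_ f ×
                     ((n : ℕ) → IDModel._∘_ M (proj₁ (f n)) (proj₂ (f n)) ≡ IDModel.biteral M α)
mainTheorem5 = model , λ α →
  splitting α ,
  splitting-injective α ,
  λ n → trans (splitting-product α n) (sym (biteral≡⟦⟧ α))
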